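{- Let $\mathbf{x}$ be a sequence over a finite alphabet that is not eventually periodic and is reversal-closed. For all $n\ge 1$, \[ \tfrac{1}{2} \rho_{\mathbf{x}}(n) \leq r_{\mathbf{x}}(n) < \tfrac{1}{2} \rho_{\mathbf{x}}(n) + \tfrac{8}{n}\, \rho_{\mathbf{x}}\!\left( n + \left\lfloor\tfrac{n}{4}\right\rfloor \right). \]
   Context: A factor of a sequence is a finite contiguous block. For $u=u(1)\cdots u(m)$, $u^R=u(m)\cdots u(1)$. $\mathbf{x}$ is reversal-closed if $w^R$ is a factor for every factor $w$; eventually periodic if $\mathbf{x}=uv^\omega$ with $v$ nonempty. $\rho_{\mathbf{x}}(n)$ is the number of distinct length-$n$ factors; $r_{\mathbf{x}}(n)$ the number of distinct length-$n$ factors up to $u\sim v\iff v\in\{u,u^R\}$. -}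

module Defs where

open import Data.Nat using (ℕ; zero; suc; _+_; _≤_; _<_)
open import Data.Fin using (Fin; toℕ)
open import Data.Vec using (Vec; tabulate; reverse)
open import Data.List using (List; length)
open import Data.List.Relation.Unary.All using (All)
open import Data.List.Relation.Unary.Any using (Any)
open import Data.List.Relation.Unary.AllPairs using (AllPairs)
open import Data.Product using (Σ; ∃; _×_)
open import Data.Sum using (_⊎_)
open import Relation.Nullary using (¬_)
open import Relation.Binary.PropositionalEquality using (_≡_)

Seq : ℕ → Set
Seq k = ℕ → Fin k

block : ∀ {k} → Seq k → (i n : ℕ) → Vec (Fin k) n
block x i n = tabulate (λ j → x (i + toℕ j))

Factor : ∀ {k} → Seq k → ∀ {n} → Vec (Fin k) n → Set
Factor x {n} w = ∃ λ i → block x i n ≡ w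

ReversalClosed : ∀ {k} → Seq k → Set
ReversalClosed x = ∀ {n} (w : Vec _ n) → Factor x w → Factor x (reverse w)

EventuallyPeriodic : ∀ {k} → Seq k → Set
EventuallyPeriodic x =
  Σ ℕ λ p → Σ ℕ λ N → (0 < p) × (∀ i → N ≤ i → x (i + p) ≡ x i)

RevEquiv : ∀ {A : Set} {n} → Vec A n → Vec A n → Set
RevEquiv u v = (v ≡ u) ⊎ (v ≡ reverse u)

-- "The number of elements satisfying P, counted up to the relation _~_, is m":
-- there is a list of m elements satisfying P, pairwise non-related,
-- such that every element satisfying P is related to some list entry.
CountUpTo : {A : Set} → (A → Set) → (A → A → Set) → ℕ → Set
CountUpTo {A} P _~_ m =
  Σ (List A) λ L →
    (length L ≡ m) ×
    All P L ×
    AllPairs (λ a b → ¬ (a ~ b)) L ×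
    (∀ a → P a → Any (λ b → a ~ b) L)

IsRho : ∀ {k} → Seq k → ℕ → ℕ → Set
IsRho x n m = CountUpTo (Factor x {n}) _≡_ m

IsR : ∀ {k} → Seq k → ℕ → ℕ → Set
IsR x n m = CountUpTo (Factor x {n}) RevEquiv m

{-# OPTIONS --safe #-}
-- Every class counted by r(n) is {w, wᴿ}, so ρ(n) ≤ 2r(n); as x is reversal-closed both members are
-- factors, and a class is a singleton only for a palindrome, so 2r(n) ≤ ρ(n) + P with P the number of
-- palindromic factors of length n.  It remains to show n·P < 16·ρ(n + m) for m = ⌊n/4⌋.
--
-- Reversal-closedness lets each palindrome w occur at some s ≥ m.  If w has a period p < c ≈ (m + 1)/2,
-- that period breaks somewhere to the right, as x is not eventually periodic, and moving s to the last
-- copy of w before the break makes the c factors of length n + m starting at s, s − 1, …, s − c + 1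
-- pairwise distinct.  Three palindromes of length n starting within n/2 of each other force two of them
-- to coincide, so a factor of length n + m contains at most two palindromes of length n starting among
-- its first m + 1 positions; tagging each window by whether w is the leftmost of them makes
-- (w, j) ↦ (window, tag) injective, whence P·c ≤ 2ρ(n + m).
module Submission where

open import Defs
open import Data.Bool using (Bool; true; false)
open import Data.Empty using (⊥; ⊥-elim)
open import Data.Fin using (Fin; fromℕ<) renaming (zero to fzero; suc to fsuc; _≟_ to _≟ᶠ_)
open import Data.Fin.Properties using (toℕ-fromℕ<; injective⇒≤)
open import Data.List using (List; []; _∷_; _++_; length; lookup; map; filter; applyUpTo)
open import Data.List.Properties using (length-++; length-map; length-applyUpTo)
open import Data.List.Membership.Propositional using (_∈_)
open import Data.List.Membership.Propositional.Properties
  using (∈-lookup; ∈-++⁺ˡ; ∈-++⁺ʳ; ∈-++⁻; ∈-map⁺; ∈-map⁻; ∈-filter⁻; ∈-applyUpTo⁻)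
open import Data.List.Relation.Unary.All as All using (All)
import Data.List.Relation.Unary.All.Properties as Allₚ
open import Data.List.Relation.Unary.AllPairs as AllPairs using (AllPairs)
open import Data.List.Relation.Unary.Any as Any using (Any; here; there; index)
open import Data.List.Relation.Unary.Any.Properties using (lookup-index; Any-⊎⁻; map⁺)
open import Data.List.Relation.Unary.Unique.Propositional using (Unique)
import Data.List.Relation.Unary.Unique.Propositional.Properties as Unique
open import Data.Maybe using (Maybe; just; nothing)
open import Data.Maybe.Properties as Maybe using (just-injective)
open import Data.Nat using (ℕ; zero; suc; _+_; _*_; _∸_; _≤_; _<_; s≤s; z<s; _≤?_; _<?_; NonZero; >-nonZero)
open import Data.Nat.Properties
open import Data.Nat.Divisibility using (_∣_; divides; ∣m∣n⇒∣m+n; ∣-refl; ∣⇒≤)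
open import Data.Nat.DivMod using (_/_; _%_; m≡m%n+[m/n]*n; m%n<n; m/n*n≤m)
open import Data.Nat.Induction using (<-wellFounded)
open import Data.Nat.Tactic.RingSolver using (solve)
open import Data.Product using (∃; _×_; _,_; proj₁; proj₂)
open import Data.Sum using (_⊎_; inj₁; inj₂; [_,_]′)
open import Data.Vec using (Vec; _∷ʳ_; tabulate; reverse)
open import Data.Vec.Properties using (≡-dec; reverse-∷; reverse-involutive; reverse-reverse; reverse-injective)
open import Function using (_∘_)
open import Induction.WellFounded using (Acc; acc)
open import Level using (0ℓ)
open import Relation.Binary using (tri<; tri≈; tri>)
open import Relation.Binary.Definitions using (DecidableEquality)
open import Relation.Binary.PropositionalEquality
open import Relation.Nullary using (¬_; Dec; yes; no)
open import Relation.Nullary.Decidable using (isYes; map′; ¬?; decidable-stable; _×-dec_; _→-dec_)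
open import Relation.Nullary.Negation using (¬¬-Monad)
open import Relation.Unary using (Decidable)
open import Relation.Unary.Properties using (∁?)

even⊎odd : ∀ q → ∃ λ h → q ≡ 2 * h ⊎ q ≡ suc (2 * h)
even⊎odd zero = 0 , inj₁ refl
even⊎odd (suc q) with even⊎odd q
... | h , inj₁ refl = h , inj₂ refl
... | h , inj₂ refl = suc h , inj₁ (cong suc (sym (+-suc h (h + 0))))

∣2m∣2n⇒∣m⊎∣n⊎∣m+n : ∀ {g a b} → g ∣ 2 * a → g ∣ 2 * b → g ∣ a ⊎ g ∣ b ⊎ g ∣ a + b
∣2m∣2n⇒∣m⊎∣n⊎∣m+n {g} {a} {b} (divides q₁ e₁) (divides q₂ e₂) with even⊎odd q₁ | even⊎odd q₂
... | h₁ , inj₁ refl | _ = inj₁ (divides h₁ (*-cancelˡ-≡ a (h₁ * g) 2 (trans e₁ (*-assoc 2 h₁ g))))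
... | _ | h₂ , inj₁ refl = inj₂ (inj₁ (divides h₂ (*-cancelˡ-≡ b (h₂ * g) 2 (trans e₂ (*-assoc 2 h₂ g)))))
... | h₁ , inj₂ refl | h₂ , inj₂ refl = inj₂ (inj₂ (divides (suc (h₁ + h₂)) (*-cancelˡ-≡ (a + b) _ 2 (begin
  2 * (a + b)                                ≡⟨ *-distribˡ-+ 2 a b ⟩
  2 * a + 2 * b                              ≡⟨ cong₂ _+_ e₁ e₂ ⟩
  suc (2 * h₁) * g + suc (2 * h₂) * g        ≡⟨ solve (h₁ ∷ h₂ ∷ g ∷ []) ⟩
  2 * (suc (h₁ + h₂) * g)                    ∎))))
  where open ≡-Reasoning

m<m+n⇒0<n : ∀ {m n} → m < m + n → 0 < n
m<m+n⇒0<n {m} {n} m<m+n = +-cancelˡ-< m 0 n (subst (_< m + n) (sym (+-identityʳ m)) m<m+n)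

-- Periods and palindromes

module Segments {A : Set} (f : ℕ → A) where

  Palindrome : ℕ → ℕ → Set
  Palindrome n o = ∀ u v → suc (u + v) ≡ n → f (o + u) ≡ f (o + v)

  HasPeriod : ℕ → ℕ → ℕ → Set
  HasPeriod o L p = ∀ u → u + p < L → f (o + u) ≡ f (o + u + p)

  SameBlock : ℕ → ℕ → ℕ → Set
  SameBlock n o o′ = ∀ u → u < n → f (o + u) ≡ f (o′ + u)

  palindromes⇒period : ∀ {n o} d → Palindrome n o → Palindrome n (o + d) → HasPeriod o (d + n) (2 * d)
  palindromes⇒period {n} {o} d P Q u u+2d<d+n with m≤n⇒∃[o]m+o≡n u+d<n
    where
    u+d<n : u + d < n
    u+d<n = +-cancelˡ-< d (u + d) n (begin-strict
      d + (u + d) ≡⟨ solve (d ∷ u ∷ []) ⟩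
      u + 2 * d   <⟨ u+2d<d+n ⟩
      d + n       ∎)
      where open ≤-Reasoning
  ... | w , refl = begin
    f (o + u)           ≡⟨ P u (d + w) (solve (u ∷ d ∷ w ∷ [])) ⟩
    f (o + (d + w))     ≡⟨ cong f (sym (+-assoc o d w)) ⟩
    f (o + d + w)       ≡⟨ Q w (u + d) (solve (u ∷ d ∷ w ∷ [])) ⟩
    f (o + d + (u + d)) ≡⟨ cong f (solve (o ∷ d ∷ u ∷ [])) ⟩
    f (o + u + 2 * d)   ∎
    where open ≡-Reasoning

  period-prefix : ∀ {o L L′ p} → L′ ≤ L → HasPeriod o L p → HasPeriod o L′ p
  period-prefix L′≤L P u u+p<L′ = P u (<-≤-trans u+p<L′ L′≤L)

  period-suffix : ∀ {o a L p} → HasPeriod o (a + L) p → HasPeriod (o + a) L p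
  period-suffix {o} {a} {L} {p} P u u+p<L = begin
    f (o + a + u)       ≡⟨ cong f (+-assoc o a u) ⟩
    f (o + (a + u))     ≡⟨ P (a + u) (subst (_< a + L) (sym (+-assoc a u p)) (+-monoʳ-< a u+p<L)) ⟩
    f (o + (a + u) + p) ≡⟨ cong (λ i → f (i + p)) (sym (+-assoc o a u)) ⟩
    f (o + a + u + p)   ∎
    where open ≡-Reasoning

  period-difference : ∀ {o L p r} → p + (p + r) ≤ L → HasPeriod o L p → HasPeriod o L (p + r) → HasPeriod o L r
  period-difference {o} {L} {p} {r} le P Q u u+r<L with u + (p + r) <? L
  ... | yes u+p+r<L = begin
    f (o + u)             ≡⟨ Q u u+p+r<L ⟩
    f (o + u + (p + r))   ≡⟨ cong f (solve (o ∷ u ∷ p ∷ r ∷ [])) ⟩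
    f (o + (u + r) + p)   ≡⟨ P (u + r) u+r+p<L ⟨
    f (o + (u + r))       ≡⟨ cong f (sym (+-assoc o u r)) ⟩
    f (o + u + r)         ∎
    where
    open ≡-Reasoning
    u+r+p<L : u + r + p < L
    u+r+p<L = subst (_< L) (trans (cong (u +_) (+-comm p r)) (sym (+-assoc u r p))) u+p+r<L
  ... | no u+p+r≮L with m≤n⇒∃[o]m+o≡n (+-cancelʳ-≤ (p + r) p u (≤-trans le (≮⇒≥ u+p+r≮L)))
  ... | t , refl = begin
    f (o + (p + t))       ≡⟨ cong f (solve (o ∷ p ∷ t ∷ [])) ⟩
    f (o + t + p)         ≡⟨ P t (subst (_< L) (+-comm p t) (≤-<-trans (m≤m+n (p + t) r) u+r<L)) ⟨
    f (o + t)             ≡⟨ Q t t+p+r<L ⟩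
    f (o + t + (p + r))   ≡⟨ cong f (solve (o ∷ p ∷ t ∷ r ∷ [])) ⟩
    f (o + (p + t) + r)   ∎
    where
    open ≡-Reasoning
    t+p+r<L : t + (p + r) < L
    t+p+r<L = subst (_< L) (trans (cong (_+ r) (+-comm p t)) (+-assoc t p r)) u+r<L

  common-period : ∀ {o L} p q → 0 < p → 0 < q → p + q ≤ L → HasPeriod o L p → HasPeriod o L q →
                  ∃ λ g → 0 < g × g ∣ p × g ∣ q × HasPeriod o L g
  common-period {o} {L} p q = go p q (<-wellFounded (p + q))
    where
    go : ∀ p q → Acc _<_ (p + q) → 0 < p → 0 < q → p + q ≤ L → HasPeriod o L p → HasPeriod o L q →
         ∃ λ g → 0 < g × g ∣ p × g ∣ q × HasPeriod o L g
    go p q (acc rec) 0<p 0<q p+q≤L P Q with <-cmp p q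
    ... | tri≈ _ refl _ = p , 0<p , ∣-refl , ∣-refl , P
    ... | tri< p<q _ _ with r , refl ← m≤n⇒∃[o]m+o≡n (<⇒≤ p<q)
      with g , 0<g , g∣p , g∣r , Pg ← go p r (rec (+-monoʳ-< p (m<n+m r 0<p))) 0<p (m<m+n⇒0<n p<q)
                                          (≤-trans (m≤n+m (p + r) p) p+q≤L) P (period-difference p+q≤L P Q)
      = g , 0<g , g∣p , ∣m∣n⇒∣m+n g∣p g∣r , Pg
    ... | tri> _ _ q<p with r , refl ← m≤n⇒∃[o]m+o≡n (<⇒≤ q<p)
      with q+p≤L ← subst (_≤ L) (+-comm (q + r) q) p+q≤L
      with g , 0<g , g∣q , g∣r , Pg ← go q r (rec (m<m+n (q + r) 0<q)) 0<q (m<m+n⇒0<n q<p)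
                                          (≤-trans (m≤n+m (q + r) q) q+p≤L) Q (period-difference q+p≤L Q P)
      = g , 0<g , ∣m∣n⇒∣m+n g∣q g∣r , g∣q , Pg

  period-multiple : ∀ {o L g} → HasPeriod o L g → ∀ c u → u + c * g < L → f (o + u) ≡ f (o + u + c * g)
  period-multiple P zero u _ = cong f (sym (+-identityʳ _))
  period-multiple {o} {L} {g} P (suc c) u u+g+cg<L = begin
    f (o + u)               ≡⟨ period-multiple P c u (≤-<-trans (m≤m+n (u + c * g) g) u+cg+g<L) ⟩
    f (o + u + c * g)       ≡⟨ cong f (+-assoc o u (c * g)) ⟩
    f (o + (u + c * g))     ≡⟨ P (u + c * g) u+cg+g<L ⟩
    f (o + (u + c * g) + g) ≡⟨ cong f (solve (o ∷ u ∷ c ∷ g ∷ [])) ⟩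
    f (o + u + suc c * g)   ∎
    where
    open ≡-Reasoning
    u+cg+g<L : u + c * g + g < L
    u+cg+g<L = subst (_< L) (trans (cong (u +_) (+-comm g (c * g))) (sym (+-assoc u (c * g) g))) u+g+cg<L

  period⇒SameBlock : ∀ {n o L g δ} → HasPeriod o L g → g ∣ δ → δ + n ≤ L → SameBlock n o (o + δ)
  period⇒SameBlock {n} {o} {g = g} P (divides c refl) δ+n≤L u u<n = begin
    f (o + u)           ≡⟨ period-multiple P c u (<-≤-trans u+cg<cg+n δ+n≤L) ⟩
    f (o + u + c * g)   ≡⟨ cong f (solve (o ∷ u ∷ c ∷ g ∷ [])) ⟩
    f (o + c * g + u)   ∎
    where
    open ≡-Reasoning
    u+cg<cg+n : u + c * g < c * g + n
    u+cg<cg+n = subst (_< c * g + n) (+-comm (c * g) u) (+-monoʳ-< (c * g) u<n)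

  SameBlock-transport : ∀ {L a b y p} → SameBlock L a b → y + p < L →
                        f (b + y) ≡ f (b + y + p) → f (a + y) ≡ f (a + y + p)
  SameBlock-transport {a = a} {b} {y} {p} S y+p<L eq = begin
    f (a + y)       ≡⟨ S y (≤-<-trans (m≤m+n y p) y+p<L) ⟩
    f (b + y)       ≡⟨ eq ⟩
    f (b + y + p)   ≡⟨ cong f (+-assoc b y p) ⟩
    f (b + (y + p)) ≡⟨ S (y + p) y+p<L ⟨
    f (a + (y + p)) ≡⟨ cong f (sym (+-assoc a y p)) ⟩
    f (a + y + p)   ∎
    where open ≡-Reasoning

  period-extendʳ : ∀ {o K L q G} → L ≤ K + q → q + G ≤ K → HasPeriod o L q → HasPeriod o K G → HasPeriod o L G
  period-extendʳ {o} {K} {L} {q} {G} L≤K+q q+G≤K Pq PG u u+G<L with u + G <? K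
  ... | yes u+G<K = PG u u+G<K
  ... | no u+G≮K with t , refl ← m≤n⇒∃[o]m+o≡n (+-cancelʳ-≤ G q u (≤-trans q+G≤K (≮⇒≥ u+G≮K))) =
    let open ≡-Reasoning in begin
    f (o + (q + t))     ≡⟨ cong f (solve (o ∷ q ∷ t ∷ [])) ⟩
    f (o + t + q)       ≡⟨ Pq t (≤-<-trans (m≤m+n (t + q) G) t+q+G<L) ⟨
    f (o + t)           ≡⟨ PG t (+-cancelʳ-< q (t + G) K (<-≤-trans t+G+q<L L≤K+q)) ⟩
    f (o + t + G)       ≡⟨ cong f (+-assoc o t G) ⟩
    f (o + (t + G))     ≡⟨ Pq (t + G) t+G+q<L ⟩
    f (o + (t + G) + q) ≡⟨ cong f (solve (o ∷ t ∷ G ∷ q ∷ [])) ⟩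
    f (o + (q + t) + G) ∎
    where
    t+q+G<L : t + q + G < L
    t+q+G<L = begin-strict
      t + q + G   ≡⟨ solve (t ∷ q ∷ G ∷ []) ⟩
      q + t + G   <⟨ u+G<L ⟩
      L           ∎
      where open ≤-Reasoning
    t+G+q<L : t + G + q < L
    t+G+q<L = begin-strict
      t + G + q   ≡⟨ solve (t ∷ q ∷ G ∷ []) ⟩
      q + t + G   <⟨ u+G<L ⟩
      L           ∎
      where open ≤-Reasoning

  period-extendˡ : ∀ {o a M L q G} → a ≤ q → q + G ≤ M → a + (q + G) ≤ L →
                   HasPeriod o L q → HasPeriod (o + a) M G → HasPeriod o (a + M) G
  period-extendˡ {o} {a} {M} {L} {q} {G} a≤q q+G≤M a+q+G≤L Pq PG u u+G<a+M with u <? a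
  ... | no u≮a with t , refl ← m≤n⇒∃[o]m+o≡n (≮⇒≥ u≮a) = begin
    f (o + (a + t))     ≡⟨ cong f (sym (+-assoc o a t)) ⟩
    f (o + a + t)       ≡⟨ PG t (+-cancelˡ-< a (t + G) M (subst (_< a + M) (+-assoc a t G) u+G<a+M)) ⟩
    f (o + a + t + G)   ≡⟨ cong (λ i → f (i + G)) (+-assoc o a t) ⟩
    f (o + (a + t) + G) ∎
    where open ≡-Reasoning
  ... | yes u<a with e , refl ← m≤n⇒∃[o]m+o≡n a≤q = let open ≡-Reasoning in begin
    f (o + u)                 ≡⟨ Pq u (≤-<-trans (+-monoʳ-≤ u (m≤m+n (a + e) G)) u+q+G<L) ⟩
    f (o + u + (a + e))       ≡⟨ cong f (solve (o ∷ u ∷ a ∷ e ∷ [])) ⟩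
    f (o + a + (u + e))       ≡⟨ PG (u + e) u+e+G<M ⟩
    f (o + a + (u + e) + G)   ≡⟨ cong f (solve (o ∷ a ∷ u ∷ e ∷ G ∷ [])) ⟩
    f (o + (u + G) + (a + e)) ≡⟨ Pq (u + G) u+G+q<L ⟨
    f (o + (u + G))           ≡⟨ cong f (sym (+-assoc o u G)) ⟩
    f (o + u + G)             ∎
    where
    u+q+G<L : u + (a + e + G) < L
    u+q+G<L = <-≤-trans (+-monoˡ-< (a + e + G) u<a) a+q+G≤L
    u+G+q<L : u + G + (a + e) < L
    u+G+q<L = begin-strict
      u + G + (a + e) ≡⟨ solve (u ∷ G ∷ a ∷ e ∷ []) ⟩
      u + (a + e + G) <⟨ u+q+G<L ⟩
      L               ∎
      where open ≤-Reasoning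
    u+e+G<M : u + e + G < M
    u+e+G<M = begin-strict
      u + e + G       ≡⟨ solve (u ∷ e ∷ G ∷ []) ⟩
      u + (e + G)     <⟨ +-monoˡ-< (e + G) u<a ⟩
      a + (e + G)     ≡⟨ solve (a ∷ e ∷ G ∷ []) ⟩
      a + e + G       ≤⟨ q+G≤M ⟩
      M               ∎
      where open ≤-Reasoning

  -- Reflections in the centres of the palindromes give the periods 2d₁ and 2d₂; a common divisor G of
  -- both that is a period of the middle palindrome extends to the whole union, and since G divides d₁, d₂
  -- or d₁ + d₂, two of the three palindromes coincide.
  three-palindromes : ∀ {n o d₁ d₂} → 0 < d₁ → 0 < d₂ → 2 * (d₁ + d₂) ≤ n →
                      Palindrome n o → Palindrome n (o + d₁) → Palindrome n (o + d₁ + d₂) →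
                      SameBlock n o (o + d₁) ⊎ SameBlock n (o + d₁) (o + d₁ + d₂) ⊎ SameBlock n o (o + d₁ + d₂)
  three-palindromes {n} {o} {d₁@(suc _)} {d₂@(suc _)} _ _ 2[d₁+d₂]≤n P₁ P₂ P₃ =
    let _ , _ , G∣2d₁ , G∣2d₂ , PG = common-period (2 * d₁) (2 * d₂) z<s z<s 2d₁+2d₂≤n
                                       (period-suffix P₁₂) (period-prefix (m≤n+m n d₂) P₂₃)
    in  coincide (extend PG (∣⇒≤ G∣2d₁) (∣⇒≤ G∣2d₂)) (∣2m∣2n⇒∣m⊎∣n⊎∣m+n G∣2d₁ G∣2d₂)
    where
    2d₁+2d₂≤n : 2 * d₁ + 2 * d₂ ≤ n
    2d₁+2d₂≤n = subst (_≤ n) (*-distribˡ-+ 2 d₁ d₂) 2[d₁+d₂]≤n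
    P₁₂ : HasPeriod o (d₁ + n) (2 * d₁)
    P₁₂ = palindromes⇒period d₁ P₁ P₂
    P₂₃ : HasPeriod (o + d₁) (d₂ + n) (2 * d₂)
    P₂₃ = palindromes⇒period d₂ P₂ P₃

    extend : ∀ {G} → HasPeriod (o + d₁) n G → G ≤ 2 * d₁ → G ≤ 2 * d₂ → HasPeriod o (d₁ + (d₂ + n)) G
    extend {G} PG G≤2d₁ G≤2d₂ =
      period-extendˡ (m≤n*m d₁ 2) (≤-trans 2d₁+G≤n (m≤n+m n d₂)) (+-monoʳ-≤ d₁ 2d₁+G≤n) P₁₂
        (period-extendʳ (subst (_≤ n + 2 * d₂) (+-comm n d₂) (+-monoʳ-≤ n (m≤n*m d₂ 2))) 2d₂+G≤n P₂₃ PG)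
      where
      2d₁+G≤n : 2 * d₁ + G ≤ n
      2d₁+G≤n = ≤-trans (+-monoʳ-≤ (2 * d₁) G≤2d₂) 2d₁+2d₂≤n
      2d₂+G≤n : 2 * d₂ + G ≤ n
      2d₂+G≤n = ≤-trans (+-monoʳ-≤ (2 * d₂) G≤2d₁) (subst (_≤ n) (+-comm (2 * d₁) (2 * d₂)) 2d₁+2d₂≤n)

    coincide : ∀ {G} → HasPeriod o (d₁ + (d₂ + n)) G → G ∣ d₁ ⊎ G ∣ d₂ ⊎ G ∣ d₁ + d₂ →
               SameBlock n o (o + d₁) ⊎ SameBlock n (o + d₁) (o + d₁ + d₂) ⊎ SameBlock n o (o + d₁ + d₂)
    coincide PG (inj₁ G∣d₁)        = inj₁ (period⇒SameBlock PG G∣d₁ (+-monoʳ-≤ d₁ (m≤n+m n d₂)))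
    coincide PG (inj₂ (inj₁ G∣d₂)) = inj₂ (inj₁ (period⇒SameBlock (period-suffix PG) G∣d₂ ≤-refl))
    coincide PG (inj₂ (inj₂ G∣d))  = inj₂ (inj₂ (subst (SameBlock n o) (sym (+-assoc o d₁ d₂))
                                       (period⇒SameBlock PG G∣d (≤-reflexive (+-assoc d₁ d₂ n)))))

  palindrome? : DecidableEquality A → ∀ n o → Dec (Palindrome n o)
  palindrome? _≟_ n o = map′ mirror⇒palindrome palindrome⇒mirror
    (allUpTo? (λ u → f (o + u) ≟ f (o + (n ∸ suc u))) n)
    where
    mirror⇒palindrome : (∀ {u} → u < n → f (o + u) ≡ f (o + (n ∸ suc u))) → Palindrome n o
    mirror⇒palindrome M u v refl = subst (λ i → f (o + u) ≡ f (o + i)) (m+n∸m≡n (suc u) v) (M (s≤s (m≤m+n u v)))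
    palindrome⇒mirror : Palindrome n o → ∀ {u} → u < n → f (o + u) ≡ f (o + (n ∸ suc u))
    palindrome⇒mirror P {u} u<n = P u (n ∸ suc u) (m+[n∸m]≡n u<n)

  period? : DecidableEquality A → ∀ o L p → Dec (HasPeriod o L p)
  period? _≟_ o L p = map′ (λ h u u+p<L → h (≤-<-trans (m≤m+n u p) u+p<L) u+p<L) (λ P {u} _ → P u)
    (allUpTo? (λ u → (u + p <? L) →-dec (f (o + u) ≟ f (o + u + p))) L)

-- Palindromes inside a window, and the tag

palindrome-transfer : ∀ {B : Set} {f g : ℕ → B} {n o o′} → (∀ u → u < n → f (o + u) ≡ g (o′ + u)) →
                      Segments.Palindrome f n o → Segments.Palindrome g n o′
palindrome-transfer agree P u v refl =
  trans (sym (agree u (s≤s (m≤m+n u v)))) (trans (P u v refl) (agree v (s≤s (m≤n+m v u))))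

module _ {A : Set} where
  open import Data.Vec using ([]; _∷_)

  lookupℕ : ∀ {n} → Vec A n → ℕ → Maybe A
  lookupℕ []      _       = nothing
  lookupℕ (a ∷ v) zero    = just a
  lookupℕ (a ∷ v) (suc u) = lookupℕ v u

  lookupℕ-ext : ∀ {n} {v w : Vec A n} → (∀ u → u < n → lookupℕ v u ≡ lookupℕ w u) → v ≡ w
  lookupℕ-ext {v = []}    {[]}    _ = refl
  lookupℕ-ext {v = a ∷ v} {b ∷ w} h =
    cong₂ _∷_ (just-injective (h zero z<s)) (lookupℕ-ext (λ u u<n → h (suc u) (s≤s u<n)))

  lookupℕ-tabulate : ∀ {n} (g : Fin n → A) {u} (u<n : u < n) → lookupℕ (tabulate g) u ≡ just (g (fromℕ< u<n))
  lookupℕ-tabulate {suc n} g {zero}  _         = refl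
  lookupℕ-tabulate {suc n} g {suc u} (s≤s u<n) = lookupℕ-tabulate (g ∘ fsuc) u<n

  lookupℕ-∷ʳ-< : ∀ {n} (v : Vec A n) a {u} → u < n → lookupℕ (v ∷ʳ a) u ≡ lookupℕ v u
  lookupℕ-∷ʳ-< (b ∷ v) a {zero}  _         = refl
  lookupℕ-∷ʳ-< (b ∷ v) a {suc u} (s≤s u<n) = lookupℕ-∷ʳ-< v a u<n

  lookupℕ-∷ʳ : ∀ {n} (v : Vec A n) a → lookupℕ (v ∷ʳ a) n ≡ just a
  lookupℕ-∷ʳ []      a = refl
  lookupℕ-∷ʳ (b ∷ v) a = lookupℕ-∷ʳ v a

  lookupℕ-reverse : ∀ {n} (v : Vec A n) u w → suc (u + w) ≡ n → lookupℕ (reverse v) u ≡ lookupℕ v w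
  lookupℕ-reverse (a ∷ v) u zero refl rewrite reverse-∷ a v | +-identityʳ u = lookupℕ-∷ʳ (reverse v) a
  lookupℕ-reverse (a ∷ v) u (suc w) refl rewrite reverse-∷ a v =
    trans (lookupℕ-∷ʳ-< (reverse v) a (m<m+n u z<s)) (lookupℕ-reverse v u w (sym (+-suc u w)))

  reverse-palindrome : ∀ {n} {w : Vec A n} → reverse w ≡ w → Segments.Palindrome (lookupℕ w) n 0
  reverse-palindrome {w = w} rw u v e = trans (cong (λ z → lookupℕ z u) (sym rw)) (lookupℕ-reverse w u v e)

module _ {P : ℕ → Set} (P? : Decidable P) where

  minimal? : ∀ b → (∃ λ a → a < b × P a × ∀ {t} → t < a → ¬ P t) ⊎ (∀ {t} → t < b → ¬ P t)
  minimal? zero = inj₂ λ ()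
  minimal? (suc b) with minimal? b
  ... | inj₁ (a , a<b , Pa , before) = inj₁ (a , m≤n⇒m≤1+n a<b , Pa , before)
  ... | inj₂ none with P? b
  ...   | yes Pb = inj₁ (b , ≤-refl , Pb , none)
  ...   | no ¬Pb = inj₂ none′
    where
    none′ : ∀ {t} → t < suc b → ¬ P t
    none′ t<1+b with m<1+n⇒m<n∨m≡n t<1+b
    ... | inj₁ t<b  = none t<b
    ... | inj₂ refl = ¬Pb

Occurs : ∀ {A : Set} {N n} → Vec A N → Vec A n → ℕ → Set
Occurs {n = n} v w j = ∀ u → u < n → lookupℕ v (j + u) ≡ lookupℕ w u

module _ {A : Set} {n : ℕ} where

  occurs-unique : ∀ {N} {v : Vec A N} {w w′ : Vec A n} {j} → Occurs v w j → Occurs v w′ j → w ≡ w′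
  occurs-unique o o′ = lookupℕ-ext (λ u u<n → trans (sym (o u u<n)) (o′ u u<n))

  occurs⇒palindrome : ∀ {N} {v : Vec A N} {w : Vec A n} {j} → reverse w ≡ w → Occurs v w j →
                      Segments.Palindrome (lookupℕ v) n j
  occurs⇒palindrome {v = v} {w} rw o =
    palindrome-transfer {f = lookupℕ w} {lookupℕ v} (λ u u<n → sym (o u u<n)) (reverse-palindrome rw)

  palindromes-after-palindrome : ∀ {N} {v : Vec A N} {a d₁ d₂} {w₁ w₂ : Vec A n} →
    0 < d₁ → 0 < d₂ → 2 * (d₁ + d₂) ≤ n →
    Segments.Palindrome (lookupℕ v) n a → reverse w₁ ≡ w₁ → reverse w₂ ≡ w₂ →
    Occurs v w₁ (a + d₁) → Occurs v w₂ (a + d₁ + d₂) → Occurs v w₁ a ⊎ w₁ ≡ w₂ ⊎ Occurs v w₂ a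
  palindromes-after-palindrome {v = v} {a} {d₁} {d₂} 0<d₁ 0<d₂ bound Pa rw₁ rw₂ o₁ o₂
    with Segments.three-palindromes (lookupℕ v) 0<d₁ 0<d₂ bound Pa (occurs⇒palindrome {v = v} {j = a + d₁} rw₁ o₁)
                                                                (occurs⇒palindrome {v = v} {j = a + d₁ + d₂} rw₂ o₂)
  ... | inj₁ S₁        = inj₁ (λ u u<n → trans (S₁ u u<n) (o₁ u u<n))
  ... | inj₂ (inj₁ S)  = inj₂ (inj₁ (occurs-unique {v = v} (λ u u<n → trans (sym (S u u<n)) (o₁ u u<n)) o₂))
  ... | inj₂ (inj₂ S₂) = inj₂ (inj₂ (λ u u<n → trans (S₂ u u<n) (o₂ u u<n)))

module Tagging {A : Set} (_≟_ : DecidableEquality A) (n m : ℕ) where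

  occurs? : ∀ {N} (v : Vec A N) (w : Vec A n) j → Dec (Occurs v w j)
  occurs? v w j = map′ (λ h u → h {u}) (λ h {u} → h u)
    (allUpTo? (λ u → Maybe.≡-dec _≟_ (lookupℕ v (j + u)) (lookupℕ w u)) n)

  tag : ∀ {N} → Vec A n → Vec A N → Bool
  tag w v with minimal? (Segments.palindrome? (lookupℕ v) (Maybe.≡-dec _≟_) n) (suc m)
  ... | inj₁ (a , _) = isYes (occurs? v w a)
  ... | inj₂ _       = false

  tag-injective : ∀ {N} {v : Vec A N} {w w′ : Vec A n} {j j′} → 2 * m ≤ n → j ≤ m → j′ ≤ m →
                  reverse w ≡ w → reverse w′ ≡ w′ → Occurs v w j → Occurs v w′ j′ → w ≢ w′ →
                  tag w v ≢ tag w′ v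
  tag-injective {v = v} {w} {w′} {j} {j′} 2m≤n j≤m j′≤m rw rw′ o o′ w≢w′
    with minimal? (Segments.palindrome? (lookupℕ v) (Maybe.≡-dec _≟_) n) (suc m)
  ... | inj₂ none = ⊥-elim (none (s≤s j≤m) (occurs⇒palindrome {v = v} {j = j} rw o))
  ... | inj₁ (a , _ , Pa , before) with occurs? v w a | occurs? v w′ a
  ...   | yes oa | yes oa′ = λ _ → w≢w′ (occurs-unique {v = v} {j = a} oa oa′)
  ...   | yes _  | no _    = λ ()
  ...   | no _   | yes _   = λ ()
  ...   | no ¬oa | no ¬oa′ = λ _ → both-later (after ¬oa o rw) (after ¬oa′ o′ rw′)
    where
    after : ∀ {w : Vec A n} {j} → ¬ Occurs v w a → Occurs v w j → reverse w ≡ w → a < j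
    after {j = j} ¬oa o rw with <-cmp a j
    ... | tri< a<j _ _ = a<j
    ... | tri≈ _ refl _ = ⊥-elim (¬oa o)
    ... | tri> _ _ j<a = ⊥-elim (before j<a (occurs⇒palindrome {v = v} {j = j} rw o))

    ordered : ∀ {w₁ w₂ : Vec A n} {j₁ j₂} → a < j₁ → j₁ < j₂ → j₂ ≤ m →
              reverse w₁ ≡ w₁ → reverse w₂ ≡ w₂ →
              Occurs v w₁ j₁ → Occurs v w₂ j₂ → ¬ Occurs v w₁ a → ¬ Occurs v w₂ a → w₁ ≢ w₂ → ⊥
    ordered a<j₁ j₁<j₂ j₂≤m rw₁ rw₂ o₁ o₂ ¬o₁ ¬o₂ w₁≢w₂
      with d₁ , refl ← m≤n⇒∃[o]m+o≡n (<⇒≤ a<j₁) | d₂ , refl ← m≤n⇒∃[o]m+o≡n (<⇒≤ j₁<j₂)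
      with palindromes-after-palindrome {v = v} (m<m+n⇒0<n a<j₁) (m<m+n⇒0<n j₁<j₂) bound Pa rw₁ rw₂ o₁ o₂
      where
      bound : 2 * (d₁ + d₂) ≤ n
      bound = ≤-trans (*-monoʳ-≤ 2 (≤-trans (m≤n+m (d₁ + d₂) a) (subst (_≤ m) (+-assoc a d₁ d₂) j₂≤m)))
                      2m≤n
    ... | inj₁ o₁′        = ¬o₁ o₁′
    ... | inj₂ (inj₁ w₁≡w₂) = w₁≢w₂ w₁≡w₂
    ... | inj₂ (inj₂ o₂′) = ¬o₂ o₂′

    both-later : a < j → a < j′ → ⊥
    both-later a<j a<j′ with <-cmp j j′
    ... | tri< j<j′ _ _ = ordered a<j j<j′ j′≤m rw rw′ o o′ ¬oa ¬oa′ w≢w′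
    ... | tri≈ _ refl _ = w≢w′ (occurs-unique {v = v} {j = j} o o′)
    ... | tri> _ _ j′<j = ordered a<j′ j′<j j≤m rw′ rw o′ o ¬oa′ ¬oa (w≢w′ ∘ sym)

-- Separated occurrences of palindromes

module _ {k} (x : Seq k) where
  open Segments x

  lookupℕ-block : ∀ {i n u} → u < n → lookupℕ (block x i n) u ≡ just (x (i + u))
  lookupℕ-block {i} u<n = trans (lookupℕ-tabulate _ u<n) (cong (λ z → just (x (i + z))) (toℕ-fromℕ< u<n))

  SameBlock⇒block≡ : ∀ {n i j} → SameBlock n i j → block x i n ≡ block x j n
  SameBlock⇒block≡ S = lookupℕ-ext λ u u<n →
    trans (lookupℕ-block u<n) (trans (cong just (S u u<n)) (sym (lookupℕ-block u<n)))

  block≡⇒SameBlock : ∀ {n i j} → block x i n ≡ block x j n → SameBlock n i j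
  block≡⇒SameBlock e u u<n =
    just-injective (trans (sym (lookupℕ-block u<n)) (trans (cong (λ v → lookupℕ v u) e) (lookupℕ-block u<n)))

  palindrome-occurs-beyond : ReversalClosed x → ∀ {n} {w : Vec (Fin k) n} → Factor x w → reverse w ≡ w →
                             ∀ m → ∃ λ s → m ≤ s × block x s n ≡ w
  palindrome-occurs-beyond rc {n} {w} (i , e) rw m with rc (block x 0 (i + n + m)) (0 , refl)
  ... | t , et = t + m , m≤n+m m t , lookupℕ-ext agree
    where
    agree : ∀ u → u < n → lookupℕ (block x (t + m) n) u ≡ lookupℕ w u
    agree u u<n with u′ , refl ← m≤n⇒∃[o]m+o≡n u<n = begin
      lookupℕ (block x (t + m) n) u                  ≡⟨ lookupℕ-block u<n ⟩
      just (x (t + m + u))                           ≡⟨ cong (just ∘ x) (+-assoc t m u) ⟩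
      just (x (t + (m + u)))                         ≡⟨ lookupℕ-block (subst (m + u <_) L≡ (s≤s (m≤m+n (m + u) (i + u′)))) ⟨
      lookupℕ (block x t L) (m + u)                  ≡⟨ cong (λ v → lookupℕ v (m + u)) et ⟩
      lookupℕ (reverse (block x 0 L)) (m + u)        ≡⟨ lookupℕ-reverse (block x 0 L) (m + u) (i + u′) L≡ ⟩
      lookupℕ (block x 0 L) (i + u′)                 ≡⟨ lookupℕ-block (subst (i + u′ <_) L≡ (s≤s (m≤n+m (i + u′) (m + u)))) ⟩
      just (x (i + u′))                              ≡⟨ lookupℕ-block (m<n+m u′ z<s) ⟨
      lookupℕ (block x i n) u′                       ≡⟨ cong (λ v → lookupℕ v u′) e ⟩
      lookupℕ w u′                                   ≡⟨ reverse-palindrome rw u′ u (cong suc (+-comm u′ u)) ⟩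
      lookupℕ w u                                    ∎
      where
      open ≡-Reasoning
      L = i + n + m
      L≡ : suc (m + u + (i + u′)) ≡ i + n + m
      L≡ = solve (m ∷ u ∷ i ∷ u′ ∷ [])

m∸n+[n+o]≡m+o : ∀ {m n} o → n ≤ m → m ∸ n + (n + o) ≡ m + o
m∸n+[n+o]≡m+o {m} {n} o n≤m = trans (sym (+-assoc (m ∸ n) n o)) (cong (_+ o) (m∸n+n≡m n≤m))

half-bound : ∀ {c m q} → c + c ≤ suc (suc m) → q < c → c + q ≤ suc m
half-bound {c} {m} {q} 2c≤2+m q<c = ≤-pred (subst (_≤ suc (suc m)) (+-suc c q) (≤-trans (+-monoʳ-≤ c q<c) 2c≤2+m))

below-half : ∀ {c m q} → c + c ≤ suc (suc m) → q < c → q ≤ m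
below-half 2c≤2+m q<c = ≤-pred (≤-trans (+-monoˡ-≤ _ (m<n⇒0<n q<c)) (half-bound 2c≤2+m q<c))

module Windows {k} (x : Seq k) (n m : ℕ) where
  open Segments x

  Separated : ℕ → ℕ → Set
  Separated c s = ∀ {j d} → 0 < d → j + d < c → block x (s ∸ j) (n + m) ≢ block x (s ∸ (j + d)) (n + m)

  SeparatedOccurrence : ℕ → Vec (Fin k) n → Set
  SeparatedOccurrence c w = ∃ λ s → m ≤ s × block x s n ≡ w × Separated c s

  window-occurs : ∀ {s j} {w : Vec (Fin k) n} → j ≤ m → m ≤ s → block x s n ≡ w →
                  Occurs (block x (s ∸ j) (n + m)) w j
  window-occurs {s} {j} {w} j≤m m≤s e u u<n = begin
    lookupℕ (block x (s ∸ j) (n + m)) (j + u) ≡⟨ lookupℕ-block x (subst (_< n + m) (+-comm u j) (+-mono-<-≤ u<n j≤m)) ⟩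
    just (x (s ∸ j + (j + u)))                ≡⟨ cong (just ∘ x) (m∸n+[n+o]≡m+o u (≤-trans j≤m m≤s)) ⟩
    just (x (s + u))                          ≡⟨ lookupℕ-block x u<n ⟨
    lookupℕ (block x s n) u                   ≡⟨ cong (λ v → lookupℕ v u) e ⟩
    lookupℕ w u                               ∎
    where open ≡-Reasoning

  equal-windows⇒period : ∀ {s j d} → j + d ≤ m → m ≤ s →
                         block x (s ∸ j) (n + m) ≡ block x (s ∸ (j + d)) (n + m) → HasPeriod s n d
  equal-windows⇒period {s} {j} {d} j+d≤m m≤s eq u u+d<n = begin
    x (s + u)                     ≡⟨ cong x (m∸n+[n+o]≡m+o u (≤-trans j+d≤m m≤s)) ⟨
    x (s ∸ (j + d) + (j + d + u)) ≡⟨ block≡⇒SameBlock x eq (j + d + u) j+d+u<n+m ⟨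
    x (s ∸ j + (j + d + u))       ≡⟨ cong (λ i → x (s ∸ j + i)) (+-assoc j d u) ⟩
    x (s ∸ j + (j + (d + u)))     ≡⟨ cong x (m∸n+[n+o]≡m+o (d + u) (≤-trans (m≤m+n j d) (≤-trans j+d≤m m≤s))) ⟩
    x (s + (d + u))               ≡⟨ cong x (solve (s ∷ d ∷ u ∷ [])) ⟩
    x (s + u + d)                 ∎
    where
    open ≡-Reasoning
    j+d+u<n+m : j + d + u < n + m
    j+d+u<n+m = subst (_< n + m) (+-comm u (j + d)) (+-mono-<-≤ (≤-<-trans (m≤m+n u d) u+d<n) j+d≤m)

  -- Equal windows at distance d would carry the equality x (z ∸ d) ≡ x (z ∸ d + p), which holds inside
  -- the run, onto the break z = s₀ + δ that both windows contain.
  separated-before-break : ∀ {c p s₀ δ s r} → m ≤ n → m ≤ s → c + p ≤ suc m → r < p → n ≤ δ + p →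
                           s + n + r ≡ s₀ + δ + p → HasPeriod s₀ (δ + p) p → x (s₀ + δ) ≢ x (s₀ + δ + p) →
                           Separated c s
  separated-before-break {p = p} {s₀} {δ} {s} {r} m≤n m≤s c+p≤1+m r<p n≤δ+p s+n+r≡ run break {j} {d} 0<d j+d<c eq =
    repeats-break (proj₂ (m≤n⇒∃[o]m+o≡n j+d≤s)) (proj₂ (m≤n⇒∃[o]m+o≡n d≤δ))
                  (proj₂ (m≤n⇒∃[o]m+o≡n p≤n))
    where
    j+d+p≤m : j + d + p ≤ m
    j+d+p≤m = ≤-pred (≤-trans (+-monoˡ-≤ p j+d<c) c+p≤1+m)
    p≤n : p ≤ n
    p≤n = ≤-trans (m≤n+m p (j + d)) (≤-trans j+d+p≤m m≤n)
    j+d≤s : j + d ≤ s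
    j+d≤s = ≤-trans (m≤m+n (j + d) p) (≤-trans j+d+p≤m m≤s)
    d≤δ : d ≤ δ
    d≤δ = +-cancelʳ-≤ p d δ (begin
      d + p       ≤⟨ m≤n+m (d + p) j ⟩
      j + (d + p) ≡⟨ +-assoc j d p ⟨
      j + d + p   ≤⟨ j+d+p≤m ⟩
      m           ≤⟨ m≤n ⟩
      n           ≤⟨ n≤δ+p ⟩
      δ + p       ∎)
      where open ≤-Reasoning
    j+r<m : j + r < m
    j+r<m = <-≤-trans (+-monoʳ-< j r<p) (≤-trans (+-monoˡ-≤ p (m≤m+n j d)) j+d+p≤m)

    repeats-break : ∀ {B e n₁} → j + d + B ≡ s → d + e ≡ δ → p + n₁ ≡ n → ⊥
    repeats-break {B} {e} {n₁} refl refl p+n₁≡n = break (let open ≡-Reasoning in begin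
      x (s₀ + (d + e))           ≡⟨ cong x d+B+y≡ ⟨
      x (d + B + (j + n₁ + r))     ≡⟨ SameBlock-transport window y+p<n+m B-run ⟩
      x (d + B + (j + n₁ + r) + p) ≡⟨ cong (λ i → x (i + p)) d+B+y≡ ⟩
      x (s₀ + (d + e) + p)       ∎)
      where
      B+y≡ : B + (j + n₁ + r) ≡ s₀ + e
      B+y≡ = +-cancelʳ-≡ (d + p) (B + (j + n₁ + r)) (s₀ + e) (begin
        B + (j + n₁ + r) + (d + p) ≡⟨ solve (B ∷ j ∷ n₁ ∷ r ∷ d ∷ p ∷ []) ⟩
        j + d + B + (p + n₁) + r   ≡⟨ cong (λ i → j + d + B + i + r) p+n₁≡n ⟩
        j + d + B + n + r          ≡⟨ s+n+r≡ ⟩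
        s₀ + (d + e) + p           ≡⟨ solve (s₀ ∷ d ∷ e ∷ p ∷ []) ⟩
        s₀ + e + (d + p)           ∎)
        where open ≡-Reasoning
      d+B+y≡ : d + B + (j + n₁ + r) ≡ s₀ + (d + e)
      d+B+y≡ = begin
        d + B + (j + n₁ + r)   ≡⟨ +-assoc d B (j + n₁ + r) ⟩
        d + (B + (j + n₁ + r)) ≡⟨ cong (d +_) B+y≡ ⟩
        d + (s₀ + e)           ≡⟨ solve (d ∷ s₀ ∷ e ∷ []) ⟩
        s₀ + (d + e)           ∎
        where open ≡-Reasoning
      y+p<n+m : j + n₁ + r + p < n + m
      y+p<n+m = begin-strict
        j + n₁ + r + p   ≡⟨ solve (j ∷ n₁ ∷ r ∷ p ∷ []) ⟩
        j + r + (p + n₁) ≡⟨ cong (j + r +_) p+n₁≡n ⟩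
        j + r + n        <⟨ +-monoˡ-< n j+r<m ⟩
        m + n            ≡⟨ +-comm m n ⟩
        n + m            ∎
        where open ≤-Reasoning
      window : SameBlock (n + m) (d + B) B
      window = subst₂ (SameBlock (n + m)) (trans (cong (_∸ j) (+-assoc j d B)) (m+n∸m≡n j (d + B)))
                                         (m+n∸m≡n (j + d) B) (block≡⇒SameBlock x eq)
      B-run : x (B + (j + n₁ + r)) ≡ x (B + (j + n₁ + r) + p)
      B-run = subst (λ i → x i ≡ x (i + p)) (sym B+y≡) (run e (+-monoˡ-< p (m<n+m e 0<d)))

  -- The new occurrence is the last copy of w in the run x[s₀, s₀ + δ + p) of period p.
  break⇒separated : ∀ {c p s₀ δ} → 0 < p → m ≤ n → m ≤ s₀ → c + p ≤ suc m →
                    HasPeriod s₀ n p → HasPeriod s₀ (δ + p) p → x (s₀ + δ) ≢ x (s₀ + δ + p) →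
                    SeparatedOccurrence c (block x s₀ n)
  break⇒separated {p = p} {s₀} {δ} 0<p m≤n m≤s₀ c+p≤1+m Pw run break =
    s₀ + D / p * p , m≤s , sym (SameBlock⇒block≡ x copy) ,
    separated-before-break m≤n m≤s c+p≤1+m (m%n<n D p) n≤δ+p (last-copy {D / p} (m≡m%n+[m/n]*n D p)) run break
    where
    instance
      _ : NonZero p
      _ = >-nonZero 0<p
    n≤δ+p : n ≤ δ + p
    n≤δ+p with δ + p <? n
    ... | yes δ+p<n = ⊥-elim (break (Pw δ δ+p<n))
    ... | no δ+p≮n = ≮⇒≥ δ+p≮n
    D = δ + p ∸ n
    m≤s : m ≤ s₀ + D / p * p
    m≤s = ≤-trans m≤s₀ (m≤m+n s₀ (D / p * p))
    copy : SameBlock n s₀ (s₀ + D / p * p)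
    copy = period⇒SameBlock run (divides (D / p) refl) (begin
      D / p * p + n   ≤⟨ +-monoˡ-≤ n (m/n*n≤m D p) ⟩
      D + n           ≡⟨ +-comm D n ⟩
      n + D           ≡⟨ m+[n∸m]≡n n≤δ+p ⟩
      δ + p           ∎)
      where open ≤-Reasoning
    last-copy : ∀ {q r} → D ≡ r + q * p → s₀ + q * p + n + r ≡ s₀ + δ + p
    last-copy {q} {r} D≡r+qp = begin
      s₀ + q * p + n + r     ≡⟨ solve (s₀ ∷ q ∷ p ∷ n ∷ r ∷ []) ⟩
      s₀ + (n + (r + q * p)) ≡⟨ cong (λ i → s₀ + (n + i)) D≡r+qp ⟨
      s₀ + (n + D)           ≡⟨ cong (s₀ +_) (m+[n∸m]≡n n≤δ+p) ⟩
      s₀ + (δ + p)           ≡⟨ +-assoc s₀ δ p ⟨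
      s₀ + δ + p             ∎
      where open ≡-Reasoning

  -- Locating the first break of a short period of w is the one non-constructive step.
  separated-occurrence : ¬ EventuallyPeriodic x → ∀ {c s₀} → c + c ≤ suc (suc m) → m ≤ n → m ≤ s₀ →
                         ¬ ¬ SeparatedOccurrence c (block x s₀ n)
  separated-occurrence aperiodic {c} {s₀} 2c≤2+m m≤n m≤s₀
    with anyUpTo? (λ p → (0 <? p) ×-dec period? _≟ᶠ_ s₀ n p) c
  ... | no no-short-period = λ k → k (s₀ , m≤s₀ , refl , separated)
    where
    separated : Separated c s₀
    separated {j} {d} 0<d j+d<c eq =
      no-short-period (d , ≤-<-trans (m≤n+m d j) j+d<c , 0<d , equal-windows⇒period (below-half 2c≤2+m j+d<c) m≤s₀ eq)
  ... | yes (p , p<c , 0<p , Pp) = λ k → aperiodic (p , s₀ , 0<p , periodic k)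
    where
    periodic : ¬ SeparatedOccurrence c (block x s₀ n) → ∀ i → s₀ ≤ i → x (i + p) ≡ x i
    periodic k i s₀≤i with t , refl ← m≤n⇒∃[o]m+o≡n s₀≤i
      with minimal? (λ t → ¬? (x (s₀ + t + p) ≟ᶠ x (s₀ + t))) (suc t)
    ... | inj₂ no-break = decidable-stable (x (s₀ + t + p) ≟ᶠ x (s₀ + t)) (no-break ≤-refl)
    ... | inj₁ (δ , _ , break , before) =
      ⊥-elim (k (break⇒separated 0<p m≤n m≤s₀ (half-bound 2c≤2+m p<c) Pp run (break ∘ sym)))
      where
      run : HasPeriod s₀ (δ + p) p
      run u u+p<δ+p = sym (decidable-stable (x (s₀ + u + p) ≟ᶠ x (s₀ + u)) (before (+-cancelʳ-< p u δ u+p<δ+p)))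

-- Counting up to reversal

module _ {A : Set} where
  open import Data.List.Relation.Unary.AllPairs using ([]; _∷_)

  lookup-injective : ∀ {L : List A} → Unique L → ∀ {i j} → lookup L i ≡ lookup L j → i ≡ j
  lookup-injective (_ ∷ _)        {fzero}  {fzero}  _ = refl
  lookup-injective (a∉L ∷ _)      {fzero}  {fsuc j} e = ⊥-elim (All.lookup a∉L (∈-lookup j) e)
  lookup-injective (a∉L ∷ _)      {fsuc i} {fzero}  e = ⊥-elim (All.lookup a∉L (∈-lookup i) (sym e))
  lookup-injective (_ ∷ distinct) {fsuc i} {fsuc j} e = cong fsuc (lookup-injective distinct e)

  Unique-⊆⇒length≤ : ∀ {L F : List A} → Unique L → (∀ {a} → a ∈ L → a ∈ F) → length L ≤ length F
  Unique-⊆⇒length≤ {L} {F} distinct L⊆F = injective⇒≤ injective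
    where
    position : Fin (length L) → Fin (length F)
    position i = index (L⊆F (∈-lookup i))
    injective : ∀ {i j} → position i ≡ position j → i ≡ j
    injective {i} {j} e = lookup-injective distinct (begin
      lookup L i                  ≡⟨ lookup-index (L⊆F (∈-lookup i)) ⟩
      lookup F (position i)       ≡⟨ cong (lookup F) e ⟩
      lookup F (position j)       ≡⟨ lookup-index (L⊆F (∈-lookup j)) ⟨
      lookup L j                  ∎)
      where open ≡-Reasoning

  length-filter-∁ : ∀ {P : A → Set} (P? : Decidable P) xs → length (filter P? xs) + length (filter (∁? P?) xs) ≡ length xs
  length-filter-∁ P? [] = refl
  length-filter-∁ P? (a ∷ xs) with P? a
  ... | yes _ = cong suc (length-filter-∁ P? xs)
  ... | no _  = trans (+-suc _ _) (cong suc (length-filter-∁ P? xs))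

  AllPairs-∈ : ∀ {S : A → A → Set} {L a b} → AllPairs S L → a ∈ L → b ∈ L → a ≢ b → S a b ⊎ S b a
  AllPairs-∈ (_ ∷ _)   (here refl) (here refl) a≢b = ⊥-elim (a≢b refl)
  AllPairs-∈ (Sa ∷ _)  (here refl) (there b∈L) _   = inj₁ (All.lookup Sa b∈L)
  AllPairs-∈ (Sb ∷ _)  (there a∈L) (here refl) _   = inj₂ (All.lookup Sb a∈L)
  AllPairs-∈ (_ ∷ SL)  (there a∈L) (there b∈L) a≢b = AllPairs-∈ SL a∈L b∈L a≢b

module _ {k} (x : Seq k) {n : ℕ} where

  private
    palindromic? : Decidable (λ (w : Vec (Fin k) n) → reverse w ≡ w)
    palindromic? w = ≡-dec _≟ᶠ_ (reverse w) w

  ∈-++-reverse : ∀ {R : List (Vec (Fin k) n)} {w} → Any (RevEquiv w) R → w ∈ R ++ map reverse R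
  ∈-++-reverse {R} w~R =
    [ ∈-++⁺ˡ ∘ Any.map sym , ∈-++⁺ʳ R ∘ map⁺ ∘ Any.map (λ e → sym (reverse-reverse (sym e))) ]′ (Any-⊎⁻ w~R)

  ρ≤2r : ∀ {ρ r} → IsRho x n ρ → IsR x n r → ρ ≤ 2 * r
  ρ≤2r (F , refl , F-factors , F-distinct , _) (R , refl , _ , _ , R-covers) = begin
    length F                          ≤⟨ Unique-⊆⇒length≤ F-distinct F⊆R++reverse ⟩
    length (R ++ map reverse R)       ≡⟨ length-++ R ⟩
    length R + length (map reverse R) ≡⟨ cong (length R +_) (length-map reverse R) ⟩
    length R + length R               ≡⟨ cong (length R +_) (+-identityʳ (length R)) ⟨
    2 * length R                      ∎
    where
    open ≤-Reasoning
    F⊆R++reverse : ∀ {w} → w ∈ F → w ∈ R ++ map reverse R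
    F⊆R++reverse w∈F = ∈-++-reverse (R-covers _ (All.lookup F-factors w∈F))

  2r≤ρ+palindromes : ReversalClosed x → ∀ {ρ r} → IsRho x n ρ → IsR x n r →
                     ∃ λ Q → Unique Q × All (Factor x) Q × All (λ w → reverse w ≡ w) Q × 2 * r ≤ ρ + length Q
  2r≤ρ+palindromes rc (F , refl , _ , F-distinct , F-covers) (R , refl , R-factors , R-apart , _) =
    Q , Unique.filter⁺ palindromic? R-distinct , Allₚ.filter⁺ palindromic? R-factors , Allₚ.all-filter palindromic? R ,
    arithmetic (length-filter-∁ palindromic? R) (Unique-⊆⇒length≤ R++NP-distinct R++NP⊆F)
    where
    Q = filter palindromic? R
    NP = filter (∁? palindromic?) R
    R-distinct : Unique R
    R-distinct = AllPairs.map (λ w≁w′ w≡w′ → w≁w′ (inj₁ (sym w≡w′))) R-apart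
    disjoint : ∀ {v} → ¬ (v ∈ R × v ∈ map reverse NP)
    disjoint (v∈R , v∈revNP) with ∈-map⁻ reverse v∈revNP
    ... | a , a∈NP , refl with ∈-filter⁻ (∁? palindromic?) a∈NP
    ...   | a∈R , ¬palindromic with AllPairs-∈ R-apart v∈R a∈R ¬palindromic
    ...     | inj₁ v≁a = v≁a (inj₂ (sym (reverse-involutive a)))
    ...     | inj₂ a≁v = a≁v (inj₂ refl)
    R++NP-distinct : Unique (R ++ map reverse NP)
    R++NP-distinct = Unique.++⁺ R-distinct
      (Unique.map⁺ reverse-injective (Unique.filter⁺ (∁? palindromic?) R-distinct)) disjoint
    R++NP⊆F : ∀ {v} → v ∈ R ++ map reverse NP → v ∈ F
    R++NP⊆F {v} v∈ with ∈-++⁻ R v∈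
    ... | inj₁ v∈R = F-covers v (All.lookup R-factors v∈R)
    ... | inj₂ v∈revNP with ∈-map⁻ reverse v∈revNP
    ...   | a , a∈NP , refl =
      F-covers (reverse a) (rc a (All.lookup R-factors (proj₁ (∈-filter⁻ (∁? palindromic?) a∈NP))))
    arithmetic : length Q + length NP ≡ length R → length (R ++ map reverse NP) ≤ length F →
                 2 * length R ≤ length F + length Q
    arithmetic split r+np≤ρ = begin
      2 * length R                       ≡⟨ cong (length R +_) (+-identityʳ (length R)) ⟩
      length R + length R                ≡⟨ cong (length R +_) split ⟨
      length R + (length Q + length NP)  ≡⟨ cong (length R +_) (+-comm (length Q) (length NP)) ⟩
      length R + (length NP + length Q)  ≡⟨ +-assoc (length R) (length NP) (length Q) ⟨
      length R + length NP + length Q    ≤⟨ +-monoˡ-≤ (length Q) (subst (_≤ length F) length-R++NP r+np≤ρ) ⟩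
      length F + length Q                ∎
      where
      open ≤-Reasoning
      length-R++NP : length (R ++ map reverse NP) ≡ length R + length NP
      length-R++NP = trans (length-++ R) (cong (length R +_) (length-map reverse NP))

-- Counting palindromes through tagged windows

module Counting {k} (x : Seq k) (n m c : ℕ) where
  open import Data.List.Relation.Unary.All using ([]; _∷_)
  open import Data.List.Relation.Unary.AllPairs using ([]; _∷_)
  open Windows x n m
  open Tagging (_≟ᶠ_ {k}) n m

  tagged-window : Vec (Fin k) n → ℕ → ℕ → Vec (Fin k) (n + m) × Bool
  tagged-window w s j = block x (s ∸ j) (n + m) , tag w (block x (s ∸ j) (n + m))

  tagged-windows : (Q : List (Vec (Fin k) n)) → All (SeparatedOccurrence c) Q → List (Vec (Fin k) (n + m) × Bool)
  tagged-windows []      []               = []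
  tagged-windows (w ∷ Q) ((s , _) ∷ occs) = applyUpTo (tagged-window w s) c ++ tagged-windows Q occs

  length-tagged-windows : ∀ Q occs → length (tagged-windows Q occs) ≡ length Q * c
  length-tagged-windows []      []               = refl
  length-tagged-windows (w ∷ Q) ((s , _) ∷ occs) = trans (length-++ (applyUpTo (tagged-window w s) c))
    (cong₂ _+_ (length-applyUpTo (tagged-window w s) c) (length-tagged-windows Q occs))

  ∈-tagged-windows : ∀ Q occs {e} → e ∈ tagged-windows Q occs →
                     ∃ λ w → w ∈ Q × ∃ λ s → m ≤ s × block x s n ≡ w × ∃ λ j → j < c × e ≡ tagged-window w s j
  ∈-tagged-windows (w ∷ Q) ((s , m≤s , bs , _) ∷ occs) e∈ with ∈-++⁻ (applyUpTo (tagged-window w s) c) e∈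
  ... | inj₁ e∈w with j , j<c , e≡ ← ∈-applyUpTo⁻ (tagged-window w s) e∈w =
    w , here refl , s , m≤s , bs , j , j<c , e≡
  ... | inj₂ e∈Q with w′ , w′∈Q , rest ← ∈-tagged-windows Q occs e∈Q = w′ , there w′∈Q , rest

  tagged-windows-distinct : 2 * m ≤ n → c + c ≤ suc (suc m) → ∀ {Q} → Unique Q → All (λ w → reverse w ≡ w) Q →
                            ∀ occs → Unique (tagged-windows Q occs)
  tagged-windows-distinct 2m≤n 2c≤2+m {[]} [] [] [] = []
  tagged-windows-distinct 2m≤n 2c≤2+m {w ∷ Q} (w∉Q ∷ Q-distinct) (rw ∷ Q-palindromic)
                          ((s , m≤s , bs , sep) ∷ occs) =
    Unique.++⁺ (Unique.applyUpTo⁺₁ (tagged-window w s) c windows-differ)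
               (tagged-windows-distinct 2m≤n 2c≤2+m Q-distinct Q-palindromic occs) tags-differ
    where
    windows-differ : ∀ {i j} → i < j → j < c → tagged-window w s i ≢ tagged-window w s j
    windows-differ i<j j<c e with d , refl ← m≤n⇒∃[o]m+o≡n (<⇒≤ i<j) =
      sep (m<m+n⇒0<n i<j) j<c (cong proj₁ e)

    tags-differ : ∀ {e} → ¬ (e ∈ applyUpTo (tagged-window w s) c × e ∈ tagged-windows Q occs)
    tags-differ (e∈w , e∈Q)
      with j , j<c , refl ← ∈-applyUpTo⁻ (tagged-window w s) e∈w
         | w′ , w′∈Q , s′ , m≤s′ , bs′ , j′ , j′<c , e≡ ← ∈-tagged-windows Q occs e∈Q
      = tag-injective {v = block x (s ∸ j) (n + m)} 2m≤n (below-half 2c≤2+m j<c) (below-half 2c≤2+m j′<c)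
          rw (All.lookup Q-palindromic w′∈Q)
          (window-occurs (below-half 2c≤2+m j<c) m≤s bs)
          (subst (λ v → Occurs v w′ j′) (sym same-window) (window-occurs (below-half 2c≤2+m j′<c) m≤s′ bs′))
          (All.lookup w∉Q w′∈Q) (trans (cong proj₂ e≡) (cong (tag w′) (sym same-window)))
      where
      same-window : block x (s ∸ j) (n + m) ≡ block x (s′ ∸ j′) (n + m)
      same-window = cong proj₁ e≡

  tagged-windows-⊆ : ∀ {F} → (∀ v → Factor x v → v ∈ F) → ∀ Q occs {e} →
                     e ∈ tagged-windows Q occs → e ∈ map (_, true) F ++ map (_, false) F
  tagged-windows-⊆ {F} F-covers Q occs e∈ with ∈-tagged-windows Q occs e∈
  ... | w , _ , s , _ , _ , j , _ , refl = ∈-×Bool (tag w (block x (s ∸ j) (n + m))) (F-covers _ (s ∸ j , refl))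
    where
    ∈-×Bool : ∀ {v} b → v ∈ F → (v , b) ∈ map (_, true) F ++ map (_, false) F
    ∈-×Bool true  v∈F = ∈-++⁺ˡ (∈-map⁺ (_, true) v∈F)
    ∈-×Bool false v∈F = ∈-++⁺ʳ (map (_, true) F) (∈-map⁺ (_, false) v∈F)

  separated-palindromes-bound : 2 * m ≤ n → c + c ≤ suc (suc m) → ∀ {ρ} → IsRho x (n + m) ρ →
                                ∀ {Q} → Unique Q → All (λ w → reverse w ≡ w) Q → All (SeparatedOccurrence c) Q →
                                length Q * c ≤ 2 * ρ
  separated-palindromes-bound 2m≤n 2c≤2+m (F , refl , _ , _ , F-covers) {Q} Q-distinct Q-palindromic occs = begin
    length Q * c                                         ≡⟨ length-tagged-windows Q occs ⟨
    length (tagged-windows Q occs)                       ≤⟨ Unique-⊆⇒length≤ distinct (tagged-windows-⊆ F-covers Q occs) ⟩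
    length (map (_, true) F ++ map (_, false) F)         ≡⟨ length-++ (map (_, true) F) ⟩
    length (map (_, true) F) + length (map (_, false) F) ≡⟨ cong₂ _+_ (length-map _ F) (length-map _ F) ⟩
    length F + length F                                  ≡⟨ cong (length F +_) (+-identityʳ (length F)) ⟨
    2 * length F                                         ∎
    where
    open ≤-Reasoning
    distinct : Unique (tagged-windows Q occs)
    distinct = tagged-windows-distinct 2m≤n 2c≤2+m Q-distinct Q-palindromic occs

module _ {k} (x : Seq k) where

  ρ-positive : ∀ {n ρ} → IsRho x n ρ → 0 < ρ
  ρ-positive (_ ∷ _ , refl , _) = z<s
  ρ-positive ([] , refl , _ , _ , F-covers) with () ← F-covers (block x 0 _) (0 , refl)

  palindromes-bound : ¬ EventuallyPeriodic x → ReversalClosed x → ∀ {n m c} → 2 * m ≤ n → c + c ≤ suc (suc m) →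
                      ∀ {ρ} → IsRho x (n + m) ρ → ∀ {Q} → Unique Q → All (Factor x) Q → All (λ w → reverse w ≡ w) Q →
                      length Q * c ≤ 2 * ρ
  palindromes-bound aperiodic rc {n} {m} {c} 2m≤n 2c≤2+m isρ Q-distinct Q-factors Q-palindromic =
    decidable-stable (_ ≤? _) (λ ¬bound →
      All.sequenceM 0ℓ ¬¬-Monad (All.zipWith separated (Q-factors , Q-palindromic))
        (λ occs → ¬bound (separated-palindromes-bound 2m≤n 2c≤2+m isρ Q-distinct Q-palindromic occs)))
    where
    open Windows x n m
    open Counting x n m c
    m≤n : m ≤ n
    m≤n = ≤-trans (m≤m+n m (m + 0)) 2m≤n
    separated : ∀ {w} → Factor x w × reverse w ≡ w → ¬ ¬ SeparatedOccurrence c w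
    separated (f , rw) with s₀ , m≤s₀ , refl ← palindrome-occurs-beyond x rc f rw m =
      separated-occurrence aperiodic 2c≤2+m m≤n m≤s₀

quarter-bounds : ∀ n → 4 * (n / 4) ≤ n × n < 4 * suc (n / 4)
quarter-bounds n with n / 4 | n % 4 | m≡m%n+[m/n]*n n 4 | m%n<n n 4
... | q | r | refl | r<4 = ≤-trans (≤-reflexive (*-comm 4 q)) (m≤n+m (q * 4) r) , (begin-strict
  r + q * 4   <⟨ +-monoˡ-< (q * 4) r<4 ⟩
  4 + q * 4   ≡⟨ solve (q ∷ []) ⟩
  4 * suc q   ∎)
  where open ≤-Reasoning

half-ceiling : ∀ m → ∃ λ c → suc m ≤ c + c × c + c ≤ suc (suc m)
half-ceiling m with even⊎odd (suc m)
... | h , inj₁ 1+m≡2h = h , ≤-reflexive 1+m≡h+h , ≤-trans (≤-reflexive (sym 1+m≡h+h)) (n≤1+n (suc m))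
  where
  1+m≡h+h : suc m ≡ h + h
  1+m≡h+h = trans 1+m≡2h (solve (h ∷ []))
... | h , inj₂ 1+m≡1+2h = suc h , ≤-trans (n≤1+n (suc m)) (≤-reflexive (sym c+c≡2+m)) , ≤-reflexive c+c≡2+m
  where
  c+c≡2+m : suc h + suc h ≡ suc (suc m)
  c+c≡2+m = begin
    suc h + suc h     ≡⟨ solve (h ∷ []) ⟩
    suc (suc (2 * h)) ≡⟨ cong suc 1+m≡1+2h ⟨
    suc (suc m)       ∎
    where open ≡-Reasoning

n*q<16ρ : ∀ {n m c ρ} → n < 4 * suc m → suc m ≤ c + c → 0 < ρ → ∀ q → q * c ≤ 2 * ρ → n * q < 16 * ρ
n*q<16ρ {n} {ρ = ρ} _ _ 0<ρ zero _ = subst (_< 16 * ρ) (sym (*-zeroʳ n)) (*-monoʳ-< 16 0<ρ)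
n*q<16ρ {n} {m} {c} {ρ} n<4[1+m] 1+m≤2c _ (suc q) qc≤2ρ = begin-strict
  n * suc q           <⟨ *-monoˡ-< (suc q) n<4[1+m] ⟩
  4 * suc m * suc q   ≤⟨ *-monoˡ-≤ (suc q) (*-monoʳ-≤ 4 1+m≤2c) ⟩
  4 * (c + c) * suc q ≡⟨ solve (c ∷ q ∷ []) ⟩
  8 * (suc q * c)     ≤⟨ *-monoʳ-≤ 8 qc≤2ρ ⟩
  8 * (2 * ρ)         ≡⟨ solve (ρ ∷ []) ⟩
  16 * ρ              ∎
  where open ≤-Reasoning

2nr<nρ+16ρ′ : ∀ {n m c q ρ ρ′ r} → n < 4 * suc m → suc m ≤ c + c → q * c ≤ 2 * ρ′ → 0 < ρ′ →
              2 * r ≤ ρ + q → 2 * n * r < n * ρ + 16 * ρ′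
2nr<nρ+16ρ′ {n} {q = q} {ρ} {ρ′} {r} n<4[1+m] 1+m≤2c qc≤2ρ′ 0<ρ′ 2r≤ρ+q = begin-strict
  2 * n * r       ≡⟨ solve (n ∷ r ∷ []) ⟩
  n * (2 * r)     ≤⟨ *-monoʳ-≤ n 2r≤ρ+q ⟩
  n * (ρ + q)     ≡⟨ *-distribˡ-+ n ρ q ⟩
  n * ρ + n * q   <⟨ +-monoʳ-< (n * ρ) (n*q<16ρ n<4[1+m] 1+m≤2c 0<ρ′ q qc≤2ρ′) ⟩
  n * ρ + 16 * ρ′ ∎
  where open ≤-Reasoning

theorem3p15 : ∀ (k : ℕ) (x : Seq k) → ¬ EventuallyPeriodic x → ReversalClosed x →
    ∀ (n : ℕ) → 1 ≤ n → ∀ (ρn r ρm : ℕ) →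
    IsRho x n ρn → IsR x n r → IsRho x (n + n / 4) ρm →
    (ρn ≤ 2 * r) × (2 * n * r < n * ρn + 16 * ρm)
theorem3p15 k x aperiodic rc n _ ρn r ρm isρn isr isρm =
  let Q , Q-distinct , Q-factors , Q-palindromic , 2r≤ρn+q = 2r≤ρ+palindromes x rc isρn isr
      c , 1+m≤2c , 2c≤2+m = half-ceiling (n / 4)
      4m≤n , n<4[1+m] = quarter-bounds n
      2m≤n = ≤-trans (*-monoˡ-≤ (n / 4) (m≤m+n 2 2)) 4m≤n
      qc≤2ρm = palindromes-bound x aperiodic rc {c = c} 2m≤n 2c≤2+m isρm Q-distinct Q-factors Q-palindromic
  in  ρ≤2r x isρn isr , 2nr<nρ+16ρ′ {c = c} n<4[1+m] 1+m≤2c qc≤2ρm (ρ-positive x isρm) 2r≤ρn+q
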